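{- Let $z$ be a composite tree of degree $n\ge 1$. Then there exist a proper divisor $d\ne 1$ of $n$ and a tree $T\in Y_{d-1}$ such that \[ z=L_{n/d}\times(\underline{0}\vee T)\quad\text{or}\quad z=R_{n/d}\times(T\vee\underline{0}).\]
   Context: A (planar binary) tree of degree $n$ is a rooted planar binary tree with $n$ trivalent internal vertices and $n+1$ leaves, drawn growing upward from its root, up to planar isotopy; $Y_n$ is the set of trees of degree $n$; $\underline{0}$, $\underline{1}$ are the unique trees of degree $0$, $1$. A grove of degree $n$ is a nonempty subset of $Y_n$; trees are identified with one-element groves. The graft $x\vee y$ attaches the root of $x$ to the left leaf and the root of $y$ to the right leaf of $\underline{1}$; each tree $x$ of positive degree is uniquely $x=x^l\vee x^r$. For $x\in Y_p,y\in Y_q$, $x/y\in Y_{p+q}$ identifies the root of $x$ with the leftmost leaf of $y$, and $x\backslash y$ identifies the rightmost leaf of $x$ with the root of $y$. $Y_n$ has the Tamari order generated by $(a\vee b)\vee c\le a\vee(b\vee c)$ and compatibility with grafting. Sum of trees: $x+y=\{z:x/y\le z\le x\backslash y\}$, extended to groves by unions over member trees. Left sum $x\dashv y=x^l\vee(x^r+y)$, right sum $x\vdash y=(x+y^l)\vee y^r$ (convention $x\vdash\underline{0}=\underline{0}\dashv y=\underline{0}$), extended to groves by unions. Product: for a tree $x$ of positive degree and grove $y$, $\underline{1}\times y=y$ and $x\times y=(x^l\times y)\vdash y\dashv(x^r\times y)$, omitting $(x^l\times y)\vdash$ when $x^l=\underline{0}$ and $\dashv(x^r\times y)$ when $x^r=\underline{0}$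 (both parenthesizations agree); for groves $x$, $x\times y=\bigcup_i x_i\times y$. A grove is prime if it is not the product of two groves both different from $\underline{1}$, and composite otherwise. The primitive trees are $L_1=R_1=\underline{1}$, $L_n=L_{n-1}\vee\underline{0}$, $R_n=\underline{0}\vee R_{n-1}$ for $n>1$. -}

module Defs where

open import Data.Nat using (ℕ; zero; suc; _+_; _*_; _∸_; _≤_)
open import Data.Product using (Σ; ∃; ∃-syntax; _×_; _,_)
open import Data.Empty using (⊥)
open import Relation.Nullary using (¬_)
open import Relation.Binary.PropositionalEquality using (_≡_)

infixr 6 _∨_

-- Planar binary trees: leaf is the tree 0 of degree 0; l ∨ r is the graft.
data Tree : Set where
  leaf : Tree
  _∨_  : Tree → Tree → Tree

deg : Tree → ℕ
deg leaf    = 0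
deg (l ∨ r) = suc (deg l + deg r)

one : Tree
one = leaf ∨ leaf

-- x / y : root of x identified with the leftmost leaf of y
_/T_ : Tree → Tree → Tree
x /T leaf    = x
x /T (l ∨ r) = (x /T l) ∨ r

-- x \ y : rightmost leaf of x identified with the root of y
_⧵T_ : Tree → Tree → Tree
leaf    ⧵T y = y
(l ∨ r) ⧵T y = l ∨ (r ⧵T y)

data _≤T_ : Tree → Tree → Set where
  ≤T-refl  : ∀ {x} → x ≤T x
  ≤T-trans : ∀ {x y z} → x ≤T y → y ≤T z → x ≤T z
  ≤T-rot   : ∀ {a b c} → ((a ∨ b) ∨ c) ≤T (a ∨ (b ∨ c))
  ≤T-left  : ∀ {x x′ y} → x ≤T x′ → (x ∨ y) ≤T (x′ ∨ y)
  ≤T-right : ∀ {x y y′} → y ≤T y′ → (x ∨ y) ≤T (x ∨ y′)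

-- Groves are represented as predicates (subsets) on trees.
Grove : Set₁
Grove = Tree → Set

IsGrove : ℕ → Grove → Set
IsGrove n X = (∃[ t ] X t) × (∀ t → X t → deg t ≡ n)

_≐_ : Grove → Grove → Set
X ≐ Y = ∀ t → (X t → Y t) × (Y t → X t)

⟦_⟧ : Tree → Grove
⟦ x ⟧ t = t ≡ x

_+T_ : Tree → Tree → Grove
(x +T y) z = ((x /T y) ≤T z) × (z ≤T (x ⧵T y))

_+G_ : Grove → Grove → Grove
(X +G Y) z = ∃[ x ] ∃[ y ] X x × Y y × (x +T y) z

_⊣T_ : Tree → Tree → Grove
(leaf ⊣T y) z    = z ≡ leaf
((l ∨ r) ⊣T y) z = ∃[ w ] (r +T y) w × (z ≡ l ∨ w)

_⊢T_ : Tree → Tree → Grove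
(x ⊢T leaf) z    = z ≡ leaf
(x ⊢T (l ∨ r)) z = ∃[ w ] (x +T l) w × (z ≡ w ∨ r)

_⊣G_ : Grove → Grove → Grove
(X ⊣G Y) z = ∃[ x ] ∃[ y ] X x × Y y × (x ⊣T y) z

_⊢G_ : Grove → Grove → Grove
(X ⊢G Y) z = ∃[ x ] ∃[ y ] X x × Y y × (x ⊢T y) z

-- product x × Y of a tree x of positive degree and a grove Y.
-- (The clause for leaf is outside the paper's domain and is never used
--  for trees of positive degree.)
prodT : Tree → Grove → Grove
prodT leaf              Y = ⟦ leaf ⟧
prodT (leaf ∨ leaf)     Y = Y
prodT (leaf ∨ (a ∨ b))  Y = Y ⊣G prodT (a ∨ b) Y
prodT ((a ∨ b) ∨ leaf)  Y = prodT (a ∨ b) Y ⊢G Y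
prodT ((a ∨ b) ∨ (c ∨ d)) Y = (prodT (a ∨ b) Y ⊢G Y) ⊣G prodT (c ∨ d) Y

_×G_ : Grove → Grove → Grove
(X ×G Y) z = ∃[ x ] X x × prodT x Y z

Composite : Tree → Set₁
Composite z = ∃[ p ] ∃[ q ] Σ Grove λ X → Σ Grove λ Y →
  (1 ≤ p) × IsGrove p X × IsGrove q Y ×
  ¬ (X ≐ ⟦ one ⟧) × ¬ (Y ≐ ⟦ one ⟧) × ((X ×G Y) ≐ ⟦ z ⟧)

-- primitive trees L_n, R_n (n ≥ 1; the value at 0 is a dummy)
L : ℕ → Tree
L zero          = leaf
L (suc zero)    = one
L (suc (suc n)) = L (suc n) ∨ leaf

R : ℕ → Tree
R zero          = leaf
R (suc zero)    = one
R (suc (suc n)) = leaf ∨ R (suc n)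

-- A factorization {z} = X × Y of groves yields one of trees, {z} = x × y for any x ∈ X, y ∈ Y,
-- because the product is monotone in its right factor and never empty.  If x × y is a single
-- tree, every interval u + v formed while evaluating it collapses to a point, which forces u or
-- v to be the leaf (for nonleaf u, v the bounds u / v and u \ v differ).  Unfolding the
-- recursive definition of the product, this makes y of the form 0 ∨ T (and then x = L_k) or
-- T ∨ 0 (and then x = R_k), while x cannot branch on both sides.  Degrees multiply, so deg y
-- is the required divisor.
module Submission where

open import Defs
open import Data.Nat using (ℕ; zero; suc; _+_; _*_; _∸_; _≤_)
open import Data.Nat.Properties using (+-suc; +-assoc; +-comm; +-identityʳ; suc-injective; m≢1+n+m; m+1+n≢m; 1+n≰n; m+n≡0⇒m≡0)
open import Data.Nat.Tactic.RingSolver using (solve-∀)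
open import Data.Product using (∃; ∃-syntax; _×_; _,_; proj₁; proj₂)
open import Data.Sum using (_⊎_; inj₁; inj₂)
open import Data.Empty using (⊥-elim)
open import Relation.Binary.PropositionalEquality
  using (_≡_; _≢_; refl; sym; trans; cong; cong₂; subst; module ≡-Reasoning)

Subsingleton : Grove → Set
Subsingleton G = ∀ {s t} → G s → G t → s ≡ t

≐⟦⟧⇒subsingleton : ∀ {G z} → ⟦ z ⟧ ≐ G → Subsingleton G
≐⟦⟧⇒subsingleton z≐G Gs Gt = trans (proj₂ (z≐G _) Gs) (sym (proj₂ (z≐G _) Gt))

nonempty-⊆⟦⟧⇒≐ : ∀ {G z} → ∃ G → (∀ t → G t → t ≡ z) → ⟦ z ⟧ ≐ G
nonempty-⊆⟦⟧⇒≐ {G} (w , Gw) G⊆z t = (λ t≡z → subst G (trans (G⊆z w Gw) (sym t≡z)) Gw) , G⊆z t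

∨-injectiveˡ : ∀ {l r l′ r′} → (l ∨ r) ≡ (l′ ∨ r′) → l ≡ l′
∨-injectiveˡ refl = refl

∨-injectiveʳ : ∀ {l r l′ r′} → (l ∨ r) ≡ (l′ ∨ r′) → r ≡ r′
∨-injectiveʳ refl = refl

deg≡0⇒≡leaf : ∀ t → deg t ≡ 0 → t ≡ leaf
deg≡0⇒≡leaf leaf _ = refl

deg≡1⇒≡one : ∀ t → deg t ≡ 1 → t ≡ one
deg≡1⇒≡one (l ∨ r) e = cong₂ _∨_ (deg≡0⇒≡leaf l (m+n≡0⇒m≡0 (deg l) e′))
                                 (deg≡0⇒≡leaf r (m+n≡0⇒m≡0 (deg r) (trans (+-comm (deg r) (deg l)) e′)))
  where
  e′ : deg l + deg r ≡ 0
  e′ = suc-injective e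

deg-L : ∀ m → deg (L (suc m)) ≡ suc m
deg-L zero    = refl
deg-L (suc m) = cong suc (trans (+-identityʳ _) (deg-L m))

deg-R : ∀ m → deg (R (suc m)) ≡ suc m
deg-R zero    = refl
deg-R (suc m) = cong suc (deg-R m)

⧵T-identityʳ : ∀ x → (x ⧵T leaf) ≡ x
⧵T-identityʳ leaf    = refl
⧵T-identityʳ (l ∨ r) = cong (l ∨_) (⧵T-identityʳ r)

/T-identityˡ : ∀ y → (leaf /T y) ≡ y
/T-identityˡ leaf    = refl
/T-identityˡ (l ∨ r) = cong (_∨ r) (/T-identityˡ l)

deg-⧵T : ∀ x y → deg (x ⧵T y) ≡ deg x + deg y
deg-⧵T leaf    y = refl
deg-⧵T (l ∨ r) y = cong suc (trans (cong (deg l +_) (deg-⧵T r y)) (sym (+-assoc (deg l) (deg r) (deg y))))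

≤T⇒deg≡ : ∀ {x y} → x ≤T y → deg x ≡ deg y
≤T⇒deg≡ ≤T-refl                = refl
≤T⇒deg≡ (≤T-trans p q)         = trans (≤T⇒deg≡ p) (≤T⇒deg≡ q)
≤T⇒deg≡ (≤T-rot {a} {b} {c})   = cong suc (trans (cong suc (+-assoc (deg a) (deg b) (deg c))) (sym (+-suc (deg a) (deg b + deg c))))
≤T⇒deg≡ (≤T-left {y = y} p)    = cong (λ k → suc (k + deg y)) (≤T⇒deg≡ p)
≤T⇒deg≡ (≤T-right {x = x} p)   = cong (λ k → suc (deg x + k)) (≤T⇒deg≡ p)

/T≤T⧵T : ∀ x y → (x /T y) ≤T (x ⧵T y)
/T≤T⧵T x leaf    = subst (x ≤T_) (sym (⧵T-identityʳ x)) ≤T-refl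
/T≤T⧵T x (l ∨ r) = ≤T-trans (≤T-left (/T≤T⧵T x l)) (graft-⧵T x)
  where
  graft-⧵T : ∀ b → ((b ⧵T l) ∨ r) ≤T (b ⧵T (l ∨ r))
  graft-⧵T leaf      = ≤T-refl
  graft-⧵T (b₁ ∨ b₂) = ≤T-trans ≤T-rot (≤T-right (graft-⧵T b₂))

/T-cancelʳ : ∀ {x x′} w → (x /T w) ≡ (x′ /T w) → x ≡ x′
/T-cancelʳ leaf    e = e
/T-cancelʳ (l ∨ r) e = /T-cancelʳ l (∨-injectiveˡ e)

/T≡⧵T⇒leaf : ∀ x y → (x /T y) ≡ (x ⧵T y) → x ≡ leaf ⊎ y ≡ leaf
/T≡⧵T⇒leaf leaf    y       _ = inj₁ refl
/T≡⧵T⇒leaf (a ∨ b) leaf    _ = inj₂ refl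
/T≡⧵T⇒leaf (a ∨ b) (c ∨ d) e = ⊥-elim (m≢1+n+m (deg d) (begin
  deg d                             ≡⟨ cong deg (∨-injectiveʳ e) ⟩
  deg (b ⧵T (c ∨ d))                ≡⟨ deg-⧵T b (c ∨ d) ⟩
  deg b + suc (deg c + deg d)       ≡⟨ +-suc (deg b) _ ⟩
  suc (deg b + (deg c + deg d))     ≡⟨ cong suc (sym (+-assoc (deg b) (deg c) (deg d))) ⟩
  suc (deg b + deg c + deg d)       ∎))
  where
  open ≡-Reasoning

+T-lower : ∀ u v → (u +T v) (u /T v)
+T-lower u v = ≤T-refl , /T≤T⧵T u v

+T-upper : ∀ u v → (u +T v) (u ⧵T v)
+T-upper u v = /T≤T⧵T u v , ≤T-refl

+T-leafˡ : ∀ v → (leaf +T v) v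
+T-leafˡ v = subst (leaf +T v) (/T-identityˡ v) (+T-lower leaf v)

deg-+T : ∀ {u v s} → (u +T v) s → deg s ≡ deg u + deg v
deg-+T {u} {v} (_ , s≤u⧵v) = trans (≤T⇒deg≡ s≤u⧵v) (deg-⧵T u v)

deg-⊣T : ∀ {l r v s} → ((l ∨ r) ⊣T v) s → deg s ≡ deg (l ∨ r) + deg v
deg-⊣T {l} {r} {v} (_ , sw , refl) =
  cong suc (trans (cong (deg l +_) (deg-+T {r} {v} sw)) (sym (+-assoc (deg l) (deg r) (deg v))))

deg-⊢T : ∀ {u l r s} → (u ⊢T (l ∨ r)) s → deg s ≡ deg u + deg (l ∨ r)
deg-⊢T {u} {l} {r} (_ , sw , refl) =
  trans (cong (λ k → suc (k + deg r)) (deg-+T {u} {l} sw))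
        (trans (cong suc (+-assoc (deg u) (deg l) (deg r))) (sym (+-suc (deg u) (deg l + deg r))))

⊣T-nonempty : ∀ u v → ∃ (u ⊣T v)
⊣T-nonempty leaf    v = leaf , refl
⊣T-nonempty (l ∨ r) v = l ∨ (r /T v) , r /T v , +T-lower r v , refl

⊢T-nonempty : ∀ u v → ∃ (u ⊢T v)
⊢T-nonempty u leaf    = leaf , refl
⊢T-nonempty u (l ∨ r) = (u /T l) ∨ r , u /T l , +T-lower u l , refl

⊣G-subsingleton⇒rightLeaf : ∀ {X Q l r w} → Subsingleton (X ⊣G Q) →
  X (l ∨ r) → Q w → w ≢ leaf → r ≡ leaf
⊣G-subsingleton⇒rightLeaf {r = r} {w} S Xx Qw w≢leaf
  with /T≡⧵T⇒leaf r w (∨-injectiveʳ (S (_ , _ , Xx , Qw , _ , +T-lower r w , refl)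
                                     (_ , _ , Xx , Qw , _ , +T-upper r w , refl)))
... | inj₁ r≡leaf = r≡leaf
... | inj₂ w≡leaf = ⊥-elim (w≢leaf w≡leaf)

⊣G-subsingleton⇒subsingletonʳ : ∀ {X Q l} → Subsingleton (X ⊣G Q) → X (l ∨ leaf) → Subsingleton Q
⊣G-subsingleton⇒subsingletonʳ S Xx {s} {t} Qs Qt =
  ∨-injectiveʳ (S (_ , s , Xx , Qs , s , +T-leafˡ s , refl) (_ , t , Xx , Qt , t , +T-leafˡ t , refl))

⊣G-subsingleton⇒subsingletonˡ : ∀ {X Q w} → Subsingleton (X ⊣G Q) → Q w → Subsingleton X
⊣G-subsingleton⇒subsingletonˡ S Qw {leaf} {leaf} Xs Xt = refl
⊣G-subsingleton⇒subsingletonˡ {w = w} S Qw {leaf} {l ∨ r} Xs Xt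
  with S (leaf , w , Xs , Qw , refl) (l ∨ r , w , Xt , Qw , r /T w , +T-lower r w , refl)
... | ()
⊣G-subsingleton⇒subsingletonˡ {w = w} S Qw {l ∨ r} {leaf} Xs Xt
  with S (l ∨ r , w , Xs , Qw , r /T w , +T-lower r w , refl) (leaf , w , Xt , Qw , refl)
... | ()
⊣G-subsingleton⇒subsingletonˡ {w = w} S Qw {l ∨ r} {l′ ∨ r′} Xs Xt =
  cong₂ _∨_ (∨-injectiveˡ e) (/T-cancelʳ w (∨-injectiveʳ e))
  where
  e : (l ∨ (r /T w)) ≡ (l′ ∨ (r′ /T w))
  e = S (l ∨ r , w , Xs , Qw , r /T w , +T-lower r w , refl) (l′ ∨ r′ , w , Xt , Qw , r′ /T w , +T-lower r′ w , refl)

⊢G-subsingleton⇒leftLeaf : ∀ {P Y u l r} → Subsingleton (P ⊢G Y) →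
  P u → u ≢ leaf → Y (l ∨ r) → l ≡ leaf
⊢G-subsingleton⇒leftLeaf {u = u} {l} S Pu u≢leaf Yy
  with /T≡⧵T⇒leaf u l (∨-injectiveˡ (S (_ , _ , Pu , Yy , _ , +T-lower u l , refl)
                                      (_ , _ , Pu , Yy , _ , +T-upper u l , refl)))
... | inj₁ u≡leaf = ⊥-elim (u≢leaf u≡leaf)
... | inj₂ l≡leaf = l≡leaf

⊢G-subsingleton⇒subsingletonˡ : ∀ {P Y r} → Subsingleton (P ⊢G Y) → Y (leaf ∨ r) → Subsingleton P
⊢G-subsingleton⇒subsingletonˡ S Yy {s} {t} Ps Pt =
  ∨-injectiveˡ (S (s , _ , Ps , Yy , s , +T-lower s leaf , refl) (t , _ , Pt , Yy , t , +T-lower t leaf , refl))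

prodT-nonempty : ∀ x y → ∃ (prodT x ⟦ y ⟧)
prodT-nonempty leaf                y = leaf , refl
prodT-nonempty (leaf ∨ leaf)       y = y , refl
prodT-nonempty (leaf ∨ (a ∨ b))    y with prodT-nonempty (a ∨ b) y
... | w , Pw with ⊣T-nonempty y w
... | s , s∈ = s , y , w , refl , Pw , s∈
prodT-nonempty ((a ∨ b) ∨ leaf)    y with prodT-nonempty (a ∨ b) y
... | u , Pu with ⊢T-nonempty u y
... | s , s∈ = s , u , y , Pu , refl , s∈
prodT-nonempty ((a ∨ b) ∨ (c ∨ d)) y with prodT-nonempty (a ∨ b) y | prodT-nonempty (c ∨ d) y
... | u , Pu | v , Qv with ⊢T-nonempty u y
... | t , t∈ with ⊣T-nonempty t v
... | s , s∈ = s , t , v , (u , y , Pu , refl , t∈) , Qv , s∈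

prodT-mono : ∀ x {Y Y′ : Grove} → (∀ t → Y t → Y′ t) → ∀ s → prodT x Y s → prodT x Y′ s
prodT-mono leaf                Y⊆Y′ s p = p
prodT-mono (leaf ∨ leaf)       Y⊆Y′ s p = Y⊆Y′ s p
prodT-mono (leaf ∨ (a ∨ b))    Y⊆Y′ s (y , w , Yy , Pw , s∈) =
  y , w , Y⊆Y′ y Yy , prodT-mono (a ∨ b) Y⊆Y′ w Pw , s∈
prodT-mono ((a ∨ b) ∨ leaf)    Y⊆Y′ s (u , y , Pu , Yy , s∈) =
  u , y , prodT-mono (a ∨ b) Y⊆Y′ u Pu , Y⊆Y′ y Yy , s∈
prodT-mono ((a ∨ b) ∨ (c ∨ d)) Y⊆Y′ s (t , v , (u , y , Pu , Yy , t∈) , Qv , s∈) =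
  t , v , (u , y , prodT-mono (a ∨ b) Y⊆Y′ u Pu , Y⊆Y′ y Yy , t∈) , prodT-mono (c ∨ d) Y⊆Y′ v Qv , s∈

prodT-⟦leaf⟧ : ∀ a b {s} → prodT (a ∨ b) ⟦ leaf ⟧ s → s ≡ leaf
prodT-⟦leaf⟧ leaf     leaf      refl                                  = refl
prodT-⟦leaf⟧ leaf     (_ ∨ _)   (_ , _ , refl , _ , s≡leaf)            = s≡leaf
prodT-⟦leaf⟧ (_ ∨ _)  leaf      (_ , _ , _ , refl , s≡leaf)            = s≡leaf
prodT-⟦leaf⟧ (_ ∨ _)  (_ ∨ _)   (_ , _ , (_ , _ , _ , refl , refl) , _ , s≡leaf) = s≡leaf

deg-prodT : ∀ a b {c d s} → prodT (a ∨ b) ⟦ c ∨ d ⟧ s → deg s ≡ deg (a ∨ b) * deg (c ∨ d)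
deg-prodT leaf leaf refl = sym (+-identityʳ _)
deg-prodT leaf (a ∨ b) {c} {d} (_ , w , refl , Pw , s∈) =
  trans (deg-⊣T {c} {d} s∈) (cong (deg (c ∨ d) +_) (deg-prodT a b Pw))
deg-prodT (a ∨ b) leaf {c} {d} (u , _ , Pu , refl , s∈) =
  trans (deg-⊢T {u} {c} {d} s∈) (trans (cong (_+ deg (c ∨ d)) (deg-prodT a b Pu))
                                       (arith (deg (a ∨ b)) (deg (c ∨ d))))
  where
  arith : ∀ m n → m * n + n ≡ n + (m + 0) * n
  arith = solve-∀
deg-prodT (a ∨ b) (a′ ∨ b′) {c} {d} (_ , v , (u , _ , Pu , refl , t∈@(_ , _ , refl)) , Qv , s∈) =
  trans (deg-⊣T s∈)
        (trans (cong₂ _+_ (trans (deg-⊢T {u} {c} {d} t∈) (cong (_+ deg (c ∨ d)) (deg-prodT a b Pu)))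
                          (deg-prodT a′ b′ Qv))
               (arith (deg (a ∨ b)) (deg (a′ ∨ b′)) (deg (c ∨ d))))
  where
  arith : ∀ m m′ n → m * n + n + m′ * n ≡ n + (m + m′) * n
  arith = solve-∀

prodT-nonleaf : ∀ a b {c d s} → prodT (a ∨ b) ⟦ c ∨ d ⟧ s → s ≢ leaf
prodT-nonleaf a b Ps refl with deg-prodT a b Ps
... | ()

data SingletonShape : Tree → Tree → Set where
  one-shape : ∀ {y} → SingletonShape one y
  L-shape   : ∀ j {T} → SingletonShape (L (2 + j)) (leaf ∨ T)
  R-shape   : ∀ j {T} → SingletonShape (R (2 + j)) (T ∨ leaf)

subsingleton-prodT⇒shape : ∀ a b {c d} → (c ∨ d) ≢ one →
  Subsingleton (prodT (a ∨ b) ⟦ c ∨ d ⟧) → SingletonShape (a ∨ b) (c ∨ d)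
subsingleton-prodT⇒shape leaf leaf y≢one S = one-shape
subsingleton-prodT⇒shape leaf (a ∨ b) {c} {d} y≢one S
  with prodT-nonempty (a ∨ b) (c ∨ d)
... | w , Pw with ⊣G-subsingleton⇒rightLeaf S refl Pw (prodT-nonleaf a b Pw)
... | refl with subsingleton-prodT⇒shape a b y≢one (⊣G-subsingleton⇒subsingletonʳ S refl)
... | one-shape = R-shape 0
... | R-shape j = R-shape (suc j)
... | L-shape j = ⊥-elim (y≢one refl)
subsingleton-prodT⇒shape (a ∨ b) leaf {c} {d} y≢one S
  with prodT-nonempty (a ∨ b) (c ∨ d)
... | u , Pu with ⊢G-subsingleton⇒leftLeaf S Pu (prodT-nonleaf a b Pu) refl
... | refl with subsingleton-prodT⇒shape a b y≢one (⊢G-subsingleton⇒subsingletonˡ S refl)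
... | one-shape = L-shape 0
... | L-shape j = L-shape (suc j)
... | R-shape j = ⊥-elim (y≢one refl)
subsingleton-prodT⇒shape (a ∨ b) (a′ ∨ b′) {c} {d} y≢one S
  with prodT-nonempty (a ∨ b) (c ∨ d) | prodT-nonempty (a′ ∨ b′) (c ∨ d)
... | u , Pu | v , Qv
  with ⊣G-subsingleton⇒rightLeaf S (u , c ∨ d , Pu , refl , u /T c , +T-lower u c , refl) Qv (prodT-nonleaf a′ b′ Qv)
... | refl with ⊢G-subsingleton⇒leftLeaf (⊣G-subsingleton⇒subsingletonˡ S Qv) Pu (prodT-nonleaf a b Pu) refl
... | refl = ⊥-elim (y≢one refl)

IsGrove-∋one⇒≐⟦one⟧ : ∀ {p X} → IsGrove p X → X one → X ≐ ⟦ one ⟧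
IsGrove-∋one⇒≐⟦one⟧ {X = X} (_ , degX) Xone t =
  (λ Xt → deg≡1⇒≡one t (trans (degX t Xt) (sym (degX one Xone)))) , (λ t≡one → subst X (sym t≡one) Xone)

composite⇒treeFactors : ∀ {z} → Composite z →
  ∃[ a ] ∃[ b ] ∃[ y ] ((a ∨ b) ≢ one) × (y ≢ one) × (⟦ z ⟧ ≐ prodT (a ∨ b) ⟦ y ⟧)
composite⇒treeFactors (_ , _ , _ , _ , 1≤p , gX@((x , Xx) , degX) , gY@((y , Yy) , _) , X≢one , Y≢one , XY≐z)
  with x | Xx | degX x Xx
... | leaf  | _  | refl = ⊥-elim (1+n≰n 1≤p)
... | a ∨ b | Xab | _ =
  a , b , y , (λ { refl → X≢one (IsGrove-∋one⇒≐⟦one⟧ gX Xab) }) , (λ { refl → Y≢one (IsGrove-∋one⇒≐⟦one⟧ gY Yy) }) ,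
  nonempty-⊆⟦⟧⇒≐ (prodT-nonempty (a ∨ b) y)
    (λ t Pt → proj₁ (XY≐z t) (a ∨ b , Xab , prodT-mono (a ∨ b) (λ { _ refl → Yy }) t Pt))

divisor-conditions : ∀ j {a b c d z} → deg (a ∨ b) ≡ 2 + j → (c ∨ d) ≢ one → prodT (a ∨ b) ⟦ c ∨ d ⟧ z →
  (deg z ≡ (2 + j) * deg (c ∨ d)) × (deg (c ∨ d) ≢ 1) × (deg (c ∨ d) ≢ deg z)
divisor-conditions j {a} {b} {c} {d} {z} deg-x y≢one z∈ =
  n≡kd , (λ e → y≢one (deg≡1⇒≡one (c ∨ d) e)) , (λ e → m+1+n≢m (deg (c ∨ d)) (sym (trans e n≡kd)))
  where
  n≡kd : deg z ≡ (2 + j) * deg (c ∨ d)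
  n≡kd = trans (deg-prodT a b z∈) (cong (_* deg (c ∨ d)) deg-x)

mainTheorem3 : (n : ℕ) → 1 ≤ n → (z : Tree) → deg z ≡ n → Composite z →
    ∃[ d ] ∃[ k ] (n ≡ k * d) × (d ≢ 1) × (d ≢ n) ×
      (∃[ T ] (deg T ≡ d ∸ 1) ×
        ((⟦ z ⟧ ≐ prodT (L k) ⟦ leaf ∨ T ⟧) ⊎ (⟦ z ⟧ ≐ prodT (R k) ⟦ T ∨ leaf ⟧)))
mainTheorem3 .(deg z) 1≤n z refl composite with composite⇒treeFactors composite
... | a , b , leaf , _ , _ , z≐ with prodT-⟦leaf⟧ a b (proj₁ (z≐ z) refl) | 1≤n
...   | refl | ()
mainTheorem3 .(deg z) 1≤n z refl composite | a , b , c ∨ d , x≢one , y≢one , z≐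
  with subsingleton-prodT⇒shape a b y≢one (≐⟦⟧⇒subsingleton z≐)
... | one-shape = ⊥-elim (x≢one refl)
... | L-shape j {T} =
  let n≡kd , d≢1 , d≢n = divisor-conditions j {L (suc j)} {leaf} (deg-L (suc j)) y≢one (proj₁ (z≐ z) refl)
  in _ , 2 + j , n≡kd , d≢1 , d≢n , T , refl , inj₁ z≐
... | R-shape j {T} =
  let n≡kd , d≢1 , d≢n = divisor-conditions j {leaf} {R (suc j)} (deg-R (suc j)) y≢one (proj₁ (z≐ z) refl)
  in _ , 2 + j , n≡kd , d≢1 , d≢n , T , sym (+-identityʳ _) , inj₂ z≐
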